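{- Let $\Gamma_n$ be the Schreier graph of the action of the Basilica group on $\{0,1\}^n$. Then the parity block decomposition of $\Gamma_n$ consists of only one parity block, so that the graph $\Gamma_n\circ_z C_4$ is a connected graph, isomorphic to the double cycle graph $DC_{2^{n+1}}$.
   Context: The Basilica group $B$ is generated by $a,b$ acting on binary words by $a(0w)=0b(w)$, $a(1w)=1w$, $b(0w)=1a(w)$, $b(1w)=0w$. The Schreier graph $\Gamma_n$ has vertex set $\{0,1\}^n$ and, for $s\in\{a,b\}$, an edge joining $u$ and $s(u)$ labelled $s$ near $u$ and $s^{ -1}$ near $s(u)$; thus $\Gamma_n$ is connected and $4$-regular with rotation map $\operatorname{Rot}_{\Gamma_n}(u,s)=(s(u),s^{ -1})$, $s\in\{a^{\pm1},b^{\pm1}\}$, and labels are identified with $[4]$ via $a\mapsto1$, $a^{ -1}\mapsto2$, $b\mapsto3$, $b^{ -1}\mapsto4$. $C_4$ has vertices $a,a^{ -1},b,b^{ -1}$ (i.e. $1,2,3,4$) with edges $a$–$a^{ -1}$, $a^{ -1}$–$b$, $b$–$b^{ -1}$, $b^{ -1}$–$a$. Zig-zag product $G\circ_z C_4$: vertex set $V(G)\times[4]$ and rotation map $\operatorname{Rot}((v,k),(i,j))=((w,l),(j',i'))$ whenever $\operatorname{Rot}_{C_4}(k,i)=(k',i')$, $\operatorname{Rot}_G(v,k')=(w,l')$, $\operatorname{Rot}_{C_4}(l',j)=(l,j')$. Parity blocks: for a vertex $v$ and $i\in\{e,o\}$, $P(v,i)$ is the subgraph formed by all paths $v=v_0,\dots,v_n$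 with $\operatorname{Rot}(v_k,i_k)=(v_{k+1},j_k)$, $i_0$ of parity $i$ and $i_{k+1}\equiv j_k\pmod 2$; these give a unique decomposition of the graph. The double cycle graph $DC_m$ is the $4$-regular graph on $2m$ vertices $x_0,\dots,x_{m-1},y_0,\dots,y_{m-1}$ in which each of $x_t,y_t$ is adjacent to each of $x_{t+1},y_{t+1}$ (indices mod $m$); equivalently every vertex lies in exactly two papillon ($K_{2,2}$) subgraphs arranged cyclically. -}

module Defs where

open import Data.Bool using (Bool; true; false; if_then_else_; _∨_; _∧_)
open import Data.Nat using (ℕ; zero; suc; _+_; _^_; _≡ᵇ_)
open import Data.Fin using (Fin; zero; suc; toℕ)
open import Data.Fin.Properties using () renaming (_≟_ to _≟F_)
open import Data.Vec using (Vec; []; _∷_)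
open import Data.Vec.Properties using () renaming (≡-dec to ≡-decVec)
open import Data.Bool.Properties using () renaming (_≟_ to _≟B_)
open import Data.Product using (Σ; ∃; _×_; _,_; proj₁; proj₂)
open import Data.Product.Properties using () renaming (≡-dec to ≡-dec×)
open import Data.Sum using (_⊎_)
open import Data.List using (List; []; _∷_; length; filter)
open import Relation.Binary.PropositionalEquality using (_≡_)
open import Relation.Binary.Definitions using (DecidableEquality)
open import Relation.Binary.Construct.Closure.ReflexiveTransitive using (Star)
open import Function.Bundles using (_↔_; Inverse)

-- Basilica group acting on binary words (false = 0, true = 1)

mutual
  bas-a : ∀ {n} → Vec Bool n → Vec Bool n
  bas-a []           = []
  bas-a (false ∷ w)  = false ∷ bas-b w
  bas-a (true ∷ w)   = true ∷ w

  bas-b : ∀ {n} → Vec Bool n → Vec Bool n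
  bas-b []           = []
  bas-b (false ∷ w)  = true ∷ bas-a w
  bas-b (true ∷ w)   = false ∷ w

mutual
  bas-a⁻¹ : ∀ {n} → Vec Bool n → Vec Bool n
  bas-a⁻¹ []          = []
  bas-a⁻¹ (false ∷ w) = false ∷ bas-b⁻¹ w
  bas-a⁻¹ (true ∷ w)  = true ∷ w

  bas-b⁻¹ : ∀ {n} → Vec Bool n → Vec Bool n
  bas-b⁻¹ []          = []
  bas-b⁻¹ (true ∷ w)  = false ∷ bas-a⁻¹ w
  bas-b⁻¹ (false ∷ w) = true ∷ w

-- Labels: Fin 4, with index 0,1,2,3 standing for the paper's labels
-- 1,2,3,4, i.e. a, a⁻¹, b, b⁻¹.

RotMap4 : Set → Set
RotMap4 V = V → Fin 4 → V × Fin 4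

gen : ∀ {n} → Fin 4 → Vec Bool n → Vec Bool n
gen zero                      = bas-a
gen (suc zero)                = bas-a⁻¹
gen (suc (suc zero))          = bas-b
gen (suc (suc (suc zero)))    = bas-b⁻¹

invLabel : Fin 4 → Fin 4
invLabel zero                   = suc zero
invLabel (suc zero)             = zero
invLabel (suc (suc zero))       = suc (suc (suc zero))
invLabel (suc (suc (suc zero))) = suc (suc zero)

RotΓ : (n : ℕ) → RotMap4 (Vec Bool n)
RotΓ n u s = gen s u , invLabel s

data Parity : Set where
  e o : Parity

parity : Fin 4 → Parity
parity zero                   = o
parity (suc zero)             = e
parity (suc (suc zero))       = o
parity (suc (suc (suc zero))) = e

-- One step of a parity path: at dart (v,i) we go along edge i to w,
-- arriving with label j, and may continue with any label i' ≡ j (mod 2).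
ParityStep : ∀ {V} → RotMap4 V → V × Fin 4 → V × Fin 4 → Set
ParityStep rot (v , i) (w , i′) =
  proj₁ (rot v i) ≡ w × parity i′ ≡ parity (proj₂ (rot v i))

-- The edge carried by dart (u,k) lies in the parity block P(v,p):
-- some parity path starting at v with first label of parity p
-- traverses that edge (in one of its two directions).
EdgeInParityBlock : ∀ {V} → RotMap4 V → V → Parity → V → Fin 4 → Set
EdgeInParityBlock rot v p u k =
  ∃ λ (i : Fin 4) → parity i ≡ p ×
    (Star (ParityStep rot) (v , i) (u , k)
     ⊎ Star (ParityStep rot) (v , i) (rot u k))

-- The parity block decomposition consists of a single block:
-- every parity block P(v,p) contains every edge of the graph.
SingleParityBlock : ∀ {V} → RotMap4 V → Set
SingleParityBlock {V} rot =
  ∀ (v : V) (p : Parity) (u : V) (k : Fin 4) → EdgeInParityBlock rot v p u k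

-- C_4 on vertices 0,1,2,3 (= a, a⁻¹, b, b⁻¹), cycle 0-1-2-3-0,
-- 2-regular, rotation map with labels Fin 2.

rotC4 : Fin 4 → Fin 2 → Fin 4 × Fin 2
rotC4 zero                   zero       = suc zero , suc zero
rotC4 (suc zero)             zero       = suc (suc zero) , suc zero
rotC4 (suc (suc zero))       zero       = suc (suc (suc zero)) , suc zero
rotC4 (suc (suc (suc zero))) zero       = zero , suc zero
rotC4 zero                   (suc zero) = suc (suc (suc zero)) , zero
rotC4 (suc zero)             (suc zero) = zero , zero
rotC4 (suc (suc zero))       (suc zero) = suc zero , zero
rotC4 (suc (suc (suc zero))) (suc zero) = suc (suc zero) , zero

rotZZ : ∀ {V} → RotMap4 V →
        V × Fin 4 → Fin 2 × Fin 2 → (V × Fin 4) × (Fin 2 × Fin 2)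
rotZZ rot (v , k) (i , j) =
  let k′ = proj₁ (rotC4 k i) ; i′ = proj₂ (rotC4 k i)
      w  = proj₁ (rot v k′)  ; l′ = proj₂ (rot v k′)
      l  = proj₁ (rotC4 l′ j) ; j′ = proj₂ (rotC4 l′ j)
  in (w , l) , (j′ , i′)

zzLabels : List (Fin 2 × Fin 2)
zzLabels = (zero , zero) ∷ (zero , suc zero) ∷ (suc zero , zero) ∷ (suc zero , suc zero) ∷ []

ZZVertex : ℕ → Set
ZZVertex n = Vec Bool n × Fin 4

_≟ZZ_ : ∀ {n} → DecidableEquality (ZZVertex n)
_≟ZZ_ = ≡-dec× (≡-decVec _≟B_) _≟F_

rotΓZ : (n : ℕ) → ZZVertex n → Fin 2 × Fin 2 → ZZVertex n × (Fin 2 × Fin 2)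
rotΓZ n = rotZZ (RotΓ n)

-- number of edges joining x and y in Γ_n ∘z C_4 (as a multigraph;
-- computed as the number of labels (i,j) at x leading to y)
multΓZ : (n : ℕ) → ZZVertex n → ZZVertex n → ℕ
multΓZ n x y = length (filter (λ ij → proj₁ (rotΓZ n x ij) ≟ZZ y) zzLabels)

AdjΓZ : (n : ℕ) → ZZVertex n → ZZVertex n → Set
AdjΓZ n x y = ∃ λ ij → proj₁ (rotΓZ n x ij) ≡ y

ConnectedΓZ : ℕ → Set
ConnectedΓZ n = ∀ x y → Star (AdjΓZ n) x y

-- Double cycle graph DC_m : vertices (t , false) = x_t, (t , true) = y_t,
-- edges {x_t,y_t} × {x_{t+1},y_{t+1}} for t ∈ ℤ/m.

isSuccMod : (m : ℕ) → Fin m → Fin m → Bool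
isSuccMod m s t = (suc (toℕ s) ≡ᵇ toℕ t) ∨ ((suc (toℕ s) ≡ᵇ m) ∧ (toℕ t ≡ᵇ 0))

DCVertex : ℕ → Set
DCVertex m = Fin m × Bool

multDC : (m : ℕ) → DCVertex m → DCVertex m → ℕ
multDC m (s , _) (t , _) =
  (if isSuccMod m s t then 1 else 0) + (if isSuccMod m t s then 1 else 0)

IsoToDC : (n m : ℕ) → Set
IsoToDC n m = Σ (ZZVertex n ↔ DCVertex m) λ f →
  ∀ x y → multΓZ n x y ≡ multDC m (Inverse.to f x) (Inverse.to f y)

module Submission where

-- The whole proof rests on one fact about the Basilica group: the element
-- c = b⁻¹a acts on {0,1}ⁿ as a conjugate of the binary odometer inc (adding 1
-- to a word read least significant digit first).  We exhibit a bijection φ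
-- with φ ∘ c = inc ∘ φ; since the odometer has a single orbit, so does c.
--
-- A c-step is traced by the parity path
--    (v,a) → (a v,b⁻¹) → (c v,a), so from (v,a) every dart with label a is
--    reached, and one more step reaches every dart; hence a single block.
--  * Connectedness.  Likewise (v,a⁻¹) → (a v,a) → (c v,a⁻¹) in Γₙ ∘z C₄.
--  * Isomorphism.  Code (v,a⁻¹),(v,b⁻¹) by the position 0·φ(v) ∈ {0,1}ⁿ⁺¹
--    and (v,a),(v,b) by 1·φ(a⁻¹v), plus a side bit.  The four neighbours of
--    every vertex are the two vertices at the odometer-predecessor position
--    and the two at the odometer-successor position; reading positions as
--    binary numbers in Fin 2ⁿ⁺¹, this is exactly the adjacency of DC_{2ⁿ⁺¹}.

open import Defs
open import Data.Nat using (ℕ; zero; suc; _^_; _+_; _*_; _<_; _≤_; z≤n; s≤s; ⌊_/2⌋)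
open import Data.Nat.Properties
  using (+-identityʳ; +-assoc; +-comm; *-suc; *-monoʳ-≤; *-cancelˡ-<; ≤-trans; ≤-refl; <-irrefl; m≤n+m; n≤1+n)
  renaming (_≟_ to _≟ℕ_)
open import Data.Bool using (Bool; true; false; if_then_else_; not; _∧_)
open import Data.Bool.Properties using () renaming (_≟_ to _≟B_)
open import Data.Fin using (Fin; zero; suc; toℕ; fromℕ<)
open import Data.Fin.Properties using (toℕ-fromℕ<; toℕ-injective; toℕ<n)
open import Data.Vec using (Vec; []; _∷_)
open import Data.Vec.Properties using (∷-injectiveʳ) renaming (≡-dec to ≡-decVec)
open import Data.Product using (∃; _×_; _,_; proj₁; proj₂)
open import Data.Product.Properties using (,-injective)
open import Data.Product.Function.NonDependent.Propositional using (_×-↔_)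
open import Data.Sum using (_⊎_; inj₁; inj₂)
open import Data.List using (List; []; _∷_; length; filter; map)
open import Data.Nat.ListAction using (sum)
open import Data.Empty using (⊥-elim)
open import Relation.Binary.PropositionalEquality
open import Relation.Binary.Construct.Closure.ReflexiveTransitive using (Star; ε; _◅_; _◅◅_)
open import Relation.Nullary using (Dec; does)
open import Relation.Nullary.Decidable using (map′; does-≡; _×-dec_; _⊎-dec_)
open import Relation.Unary using (Pred; Decidable)
open import Function.Bundles using (_↔_; Inverse; mk↔ₛ′)
open import Function.Construct.Identity using (↔-id)
open import Function.Construct.Composition using (_↔-∘_)

-- Readable names for the labels of Γₙ (a, a⁻¹, b, b⁻¹) and of C₄
-- (fwd leads from k to k+1, bwd from k to k-1).
pattern ℓa  = zero
pattern ℓa⁻ = suc zero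
pattern ℓb  = suc (suc zero)
pattern ℓb⁻ = suc (suc (suc zero))
pattern fwd = zero
pattern bwd = suc zero

mutual
  a∘a⁻¹ : ∀ {n} (w : Vec Bool n) → bas-a (bas-a⁻¹ w) ≡ w
  a∘a⁻¹ []          = refl
  a∘a⁻¹ (false ∷ w) = cong (false ∷_) (b∘b⁻¹ w)
  a∘a⁻¹ (true ∷ w)  = refl

  b∘b⁻¹ : ∀ {n} (w : Vec Bool n) → bas-b (bas-b⁻¹ w) ≡ w
  b∘b⁻¹ []          = refl
  b∘b⁻¹ (false ∷ w) = refl
  b∘b⁻¹ (true ∷ w)  = cong (true ∷_) (a∘a⁻¹ w)

mutual
  a⁻¹∘a : ∀ {n} (w : Vec Bool n) → bas-a⁻¹ (bas-a w) ≡ w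
  a⁻¹∘a []          = refl
  a⁻¹∘a (false ∷ w) = cong (false ∷_) (b⁻¹∘b w)
  a⁻¹∘a (true ∷ w)  = refl

  b⁻¹∘b : ∀ {n} (w : Vec Bool n) → bas-b⁻¹ (bas-b w) ≡ w
  b⁻¹∘b []          = refl
  b⁻¹∘b (false ∷ w) = cong (false ∷_) (a⁻¹∘a w)
  b⁻¹∘b (true ∷ w)  = refl

bas-c : ∀ {n} → Vec Bool n → Vec Bool n
bas-c w = bas-b⁻¹ (bas-a w)

inc : ∀ {k} → Vec Bool k → Vec Bool k
inc []          = []
inc (false ∷ w) = true ∷ w
inc (true ∷ w)  = false ∷ inc w

inc-injective : ∀ {k} (u w : Vec Bool k) → inc u ≡ inc w → u ≡ w
inc-injective []          []          _  = refl
inc-injective (false ∷ u) (false ∷ w) eq = cong (false ∷_) (∷-injectiveʳ eq)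
inc-injective (true ∷ u)  (true ∷ w)  eq = cong (true ∷_) (inc-injective u w (∷-injectiveʳ eq))
inc-injective (false ∷ u) (true ∷ w)  ()
inc-injective (true ∷ u)  (false ∷ w) ()

-- The conjugacy.  φ conjugates c to inc and φ′ conjugates c′ = a⁻¹b to inc;
-- the recursion on the first letter swaps the two roles.

mutual
  φ : ∀ {n} → Vec Bool n → Vec Bool n
  φ []          = []
  φ (false ∷ w) = false ∷ φ′ w
  φ (true ∷ w)  = true ∷ φ′ (bas-b⁻¹ w)

  φ′ : ∀ {n} → Vec Bool n → Vec Bool n
  φ′ []          = []
  φ′ (false ∷ w) = false ∷ φ w
  φ′ (true ∷ w)  = true ∷ φ (bas-a⁻¹ w)

mutual
  φ⁻¹ : ∀ {n} → Vec Bool n → Vec Bool n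
  φ⁻¹ []          = []
  φ⁻¹ (false ∷ u) = false ∷ φ′⁻¹ u
  φ⁻¹ (true ∷ u)  = true ∷ bas-b (φ′⁻¹ u)

  φ′⁻¹ : ∀ {n} → Vec Bool n → Vec Bool n
  φ′⁻¹ []          = []
  φ′⁻¹ (false ∷ u) = false ∷ φ⁻¹ u
  φ′⁻¹ (true ∷ u)  = true ∷ bas-a (φ⁻¹ u)

mutual
  φ∘φ⁻¹ : ∀ {n} (u : Vec Bool n) → φ (φ⁻¹ u) ≡ u
  φ∘φ⁻¹ []          = refl
  φ∘φ⁻¹ (false ∷ u) = cong (false ∷_) (φ′∘φ′⁻¹ u)
  φ∘φ⁻¹ (true ∷ u)  = cong (true ∷_) (trans (cong φ′ (b⁻¹∘b (φ′⁻¹ u))) (φ′∘φ′⁻¹ u))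

  φ′∘φ′⁻¹ : ∀ {n} (u : Vec Bool n) → φ′ (φ′⁻¹ u) ≡ u
  φ′∘φ′⁻¹ []          = refl
  φ′∘φ′⁻¹ (false ∷ u) = cong (false ∷_) (φ∘φ⁻¹ u)
  φ′∘φ′⁻¹ (true ∷ u)  = cong (true ∷_) (trans (cong φ (a⁻¹∘a (φ⁻¹ u))) (φ∘φ⁻¹ u))

mutual
  φ⁻¹∘φ : ∀ {n} (w : Vec Bool n) → φ⁻¹ (φ w) ≡ w
  φ⁻¹∘φ []          = refl
  φ⁻¹∘φ (false ∷ w) = cong (false ∷_) (φ′⁻¹∘φ′ w)
  φ⁻¹∘φ (true ∷ w)  = cong (true ∷_) (trans (cong bas-b (φ′⁻¹∘φ′ (bas-b⁻¹ w))) (b∘b⁻¹ w))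

  φ′⁻¹∘φ′ : ∀ {n} (w : Vec Bool n) → φ′⁻¹ (φ′ w) ≡ w
  φ′⁻¹∘φ′ []          = refl
  φ′⁻¹∘φ′ (false ∷ w) = cong (false ∷_) (φ⁻¹∘φ w)
  φ′⁻¹∘φ′ (true ∷ w)  = cong (true ∷_) (trans (cong bas-a (φ⁻¹∘φ (bas-a⁻¹ w))) (a∘a⁻¹ w))

mutual
  φ-conj : ∀ {n} (w : Vec Bool n) → φ (bas-c w) ≡ inc (φ w)
  φ-conj []          = refl
  φ-conj (false ∷ w) = cong (λ u → true ∷ φ′ u) (b⁻¹∘b w)
  φ-conj (true ∷ w)  = cong (false ∷_)
    (trans (cong (λ u → φ′ (bas-a⁻¹ u)) (sym (b∘b⁻¹ w))) (φ′-conj (bas-b⁻¹ w)))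

  φ′-conj : ∀ {n} (w : Vec Bool n) → φ′ (bas-a⁻¹ (bas-b w)) ≡ inc (φ′ w)
  φ′-conj []          = refl
  φ′-conj (false ∷ w) = cong (λ u → true ∷ φ u) (a⁻¹∘a w)
  φ′-conj (true ∷ w)  = cong (false ∷_)
    (trans (cong (λ u → φ (bas-b⁻¹ u)) (sym (a∘a⁻¹ w))) (φ-conj (bas-a⁻¹ w)))

Orbit : ∀ {A : Set} → (A → A) → A → A → Set
Orbit f = Star (λ x y → f x ≡ y)

orbit-conj : ∀ {A B : Set} (f : A → A) (g : B → B) (h : A → B) (h⁻¹ : B → A) →
  (∀ w → h⁻¹ (h w) ≡ w) → (∀ w → h (f w) ≡ g (h w)) →
  ∀ {x y} → Orbit g x y → ∀ v → h v ≡ x → Orbit f v (h⁻¹ y)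
orbit-conj f g h h⁻¹ left conj ε v refl = subst (Orbit f v) (sym (left v)) ε
orbit-conj f g h h⁻¹ left conj (refl ◅ s) v refl =
  refl ◅ orbit-conj f g h h⁻¹ left conj s (f v) (conj v)

-- The odometer has a single orbit: every word goes to and comes from 0…0.

zeros : ∀ {k} → Vec Bool k
zeros {zero}  = []
zeros {suc k} = false ∷ zeros

-- An orbit of inc on the tail is run at twice the speed on words starting with 0.
inc-orbit-tail : ∀ {k} {x y : Vec Bool k} → Orbit inc x y → Orbit inc (false ∷ x) (false ∷ y)
inc-orbit-tail ε          = ε
inc-orbit-tail (refl ◅ s) = refl ◅ refl ◅ inc-orbit-tail s

inc-from-zeros : ∀ {k} (y : Vec Bool k) → Orbit inc zeros y
inc-from-zeros []          = ε
inc-from-zeros (false ∷ y) = inc-orbit-tail (inc-from-zeros y)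
inc-from-zeros (true ∷ y)  = inc-orbit-tail (inc-from-zeros y) ◅◅ (refl ◅ ε)

inc-to-zeros : ∀ {k} (y : Vec Bool k) → Orbit inc y zeros
inc-to-zeros []          = ε
inc-to-zeros (false ∷ y) = inc-orbit-tail (inc-to-zeros y)
inc-to-zeros (true ∷ y)  = refl ◅ inc-orbit-tail (inc-to-zeros (inc y))

c-orbit : ∀ {n} (v u : Vec Bool n) → Orbit bas-c v u
c-orbit v u = subst (Orbit bas-c v) (φ⁻¹∘φ u)
  (orbit-conj bas-c inc φ φ⁻¹ φ⁻¹∘φ φ-conj (inc-to-zeros (φ v) ◅◅ inc-from-zeros (φ u)) v refl)

module _ {n : ℕ} where

  ParityPath : Vec Bool n × Fin 4 → Vec Bool n × Fin 4 → Set
  ParityPath = Star (ParityStep (RotΓ n))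

  -- a parity step into an explicitly named dart (the label is not inferable)
  step-to : ∀ {x z} y → ParityStep (RotΓ n) x y → ParityPath y z → ParityPath x z
  step-to y s p = s ◅ p

  -- a c-step v ↦ c v is the parity path (v,a) → (a v,b⁻¹) → (c v,a)
  c-parity-path : ∀ {v u} → Orbit bas-c v u → ParityPath (v , ℓa) (u , ℓa)
  c-parity-path ε = ε
  c-parity-path {v} (refl ◅ s) =
    step-to (bas-a v , ℓb⁻) (refl , refl) (step-to (bas-c v , ℓa) (refl , refl) (c-parity-path s))

  -- darts with odd label are entered along a⁻¹, those with even label along a
  reach-dart : ∀ (v u : Vec Bool n) k → ParityPath (v , ℓa) (u , k)
  reach-dart v u k with parity k in eq
  ... | o = c-parity-path (c-orbit v u) ◅◅
              step-to (bas-a u , ℓa⁻) (refl , refl) (step-to (u , k) (a⁻¹∘a u , eq) ε)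
  ... | e = c-parity-path (c-orbit v (bas-a⁻¹ u)) ◅◅ step-to (u , k) (a∘a⁻¹ u , eq) ε

  -- start with label a (parity o) or step to (a⁻¹v,a) first (parity e)
  single-parity-block : SingleParityBlock (RotΓ n)
  single-parity-block v o u k = ℓa , refl , inj₁ (reach-dart v u k)
  single-parity-block v e u k =
    ℓa⁻ , refl , inj₁ (step-to (bas-a⁻¹ v , ℓa) (refl , refl) (reach-dart (bas-a⁻¹ v) u k))

module _ {n : ℕ} where

  ZZPath : ZZVertex n → ZZVertex n → Set
  ZZPath = Star (AdjΓZ n)

  -- a c-step v ↦ c v is the zig-zag path (v,a⁻¹) → (a v,a) → (c v,a⁻¹)
  c-zigzag-path : ∀ {v u} → Orbit bas-c v u → ZZPath (v , ℓa⁻) (u , ℓa⁻)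
  c-zigzag-path ε          = ε
  c-zigzag-path (refl ◅ s) = ((bwd , bwd) , refl) ◅ ((bwd , bwd) , refl) ◅ c-zigzag-path s

  from-base : ∀ (v : Vec Bool n) y → ZZPath (v , ℓa⁻) y
  from-base v (w , ℓa⁻) = c-zigzag-path (c-orbit v w)
  from-base v (w , ℓb⁻) = c-zigzag-path (c-orbit v w) ◅◅
    ((bwd , bwd) , refl) ◅ ((fwd , bwd) , cong (_, ℓb⁻) (a⁻¹∘a w)) ◅ ε
  from-base v (w , ℓa)  = c-zigzag-path (c-orbit v (bas-a⁻¹ w)) ◅◅
    ((bwd , bwd) , cong (_, ℓa) (a∘a⁻¹ w)) ◅ ε
  from-base v (w , ℓb)  = c-zigzag-path (c-orbit v (bas-a⁻¹ w)) ◅◅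
    ((bwd , fwd) , cong (_, ℓb) (a∘a⁻¹ w)) ◅ ε

  to-base : ∀ x → ∃ λ (v : Vec Bool n) → ZZPath x (v , ℓa⁻)
  to-base (v , ℓa⁻) = v , ε
  to-base (v , ℓb⁻) = _ , ((fwd , bwd) , refl) ◅ ((fwd , fwd) , refl) ◅ ε
  to-base (v , ℓa)  = _ , ((fwd , fwd) , refl) ◅ ε
  to-base (v , ℓb)  = _ , ((bwd , fwd) , refl) ◅ ε

  connected : ConnectedΓZ n
  connected x y = proj₂ (to-base x) ◅◅ from-base (proj₁ (to-base x)) y

bit : Bool → ℕ
bit b = if b then 1 else 0

val : ∀ {k} → Vec Bool k → ℕ
val []      = 0
val (b ∷ w) = bit b + 2 * val w

val< : ∀ {k} (w : Vec Bool k) → val w < 2 ^ k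
val< []              = s≤s z≤n
val< {suc k} (b ∷ w) = ≤-trans (digit≤ b)
  (subst (_≤ 2 * 2 ^ k) (*-suc 2 (val w)) (*-monoʳ-≤ 2 (val< w)))
  where
  digit≤ : ∀ b → suc (bit b + 2 * val w) ≤ 2 + 2 * val w
  digit≤ false = s≤s (n≤1+n _)
  digit≤ true  = ≤-refl

lowBit : ℕ → Bool
lowBit 0             = false
lowBit 1             = true
lowBit (suc (suc x)) = lowBit x

digit-suc : ∀ b v → bit b + 2 * suc v ≡ suc (suc (bit b + 2 * v))
digit-suc false v = *-suc 2 v
digit-suc true  v = cong suc (*-suc 2 v)

⌊digit/2⌋ : ∀ b v → ⌊ bit b + 2 * v /2⌋ ≡ v
⌊digit/2⌋ false zero    = refl
⌊digit/2⌋ true  zero    = refl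
⌊digit/2⌋ b     (suc v) rewrite digit-suc b v = cong suc (⌊digit/2⌋ b v)

lowBit-digit : ∀ b v → lowBit (bit b + 2 * v) ≡ b
lowBit-digit false zero    = refl
lowBit-digit true  zero    = refl
lowBit-digit b     (suc v) rewrite digit-suc b v = lowBit-digit b v

digits : ∀ x → bit (lowBit x) + 2 * ⌊ x /2⌋ ≡ x
digits 0             = refl
digits 1             = refl
digits (suc (suc x)) = trans (digit-suc (lowBit x) ⌊ x /2⌋) (cong (λ y → suc (suc y)) (digits x))

bits : (k : ℕ) → ℕ → Vec Bool k
bits zero    _ = []
bits (suc k) x = lowBit x ∷ bits k ⌊ x /2⌋

bits-val : ∀ {k} (w : Vec Bool k) → bits k (val w) ≡ w
bits-val []      = refl
bits-val (b ∷ w) = cong₂ _∷_ (lowBit-digit b (val w))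
  (trans (cong (bits _) (⌊digit/2⌋ b (val w))) (bits-val w))

val-bits : ∀ k x → x < 2 ^ k → val (bits k x) ≡ x
val-bits zero    zero    _ = refl
val-bits zero    (suc x) (s≤s ())
val-bits (suc k) x       x< =
  trans (cong (λ y → bit (lowBit x) + 2 * y) (val-bits k ⌊ x /2⌋ ⌊x/2⌋<)) (digits x)
  where
  ⌊x/2⌋< : ⌊ x /2⌋ < 2 ^ k
  ⌊x/2⌋< = *-cancelˡ-< 2 _ _ (≤-trans
    (s≤s (subst (2 * ⌊ x /2⌋ ≤_) (digits x) (m≤n+m (2 * ⌊ x /2⌋) (bit (lowBit x))))) x<)

val-injective : ∀ {k} (u w : Vec Bool k) → val u ≡ val w → u ≡ w
val-injective u w eq = trans (sym (bits-val u)) (trans (cong (bits _) eq) (bits-val w))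

toFin : ∀ {k} → Vec Bool k → Fin (2 ^ k)
toFin w = fromℕ< (val< w)

binary : ∀ {k} → Vec Bool k ↔ Fin (2 ^ k)
binary {k} = mk↔ₛ′ toFin (λ t → bits k (toℕ t)) toFin∘bits bits∘toFin
  where
  toFin∘bits : ∀ t → toFin (bits k (toℕ t)) ≡ t
  toFin∘bits t = toℕ-injective (trans (toℕ-fromℕ< _) (val-bits k (toℕ t) (toℕ<n t)))
  bits∘toFin : ∀ w → bits k (toℕ (toFin w)) ≡ w
  bits∘toFin w = trans (cong (bits k) (toℕ-fromℕ< (val< w))) (bits-val w)

SuccMod : ℕ → ℕ → ℕ → Set
SuccMod m x y = suc x ≡ y ⊎ (suc x ≡ m × y ≡ 0)

succMod? : ∀ m x y → Dec (SuccMod m x y)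
succMod? m x y = (suc x ≟ℕ y) ⊎-dec ((suc x ≟ℕ m) ×-dec (y ≟ℕ 0))

succMod-unique : ∀ {m x y y′} → y < m → y′ < m → SuccMod m x y → SuccMod m x y′ → y ≡ y′
succMod-unique _  _   (inj₁ p)       (inj₁ q)       = trans (sym p) q
succMod-unique y< _   (inj₁ p)       (inj₂ (q , _)) = ⊥-elim (<-irrefl (trans (sym p) q) y<)
succMod-unique _  y′< (inj₂ (p , _)) (inj₁ q)       = ⊥-elim (<-irrefl (trans (sym q) p) y′<)
succMod-unique _  _   (inj₂ (_ , p)) (inj₂ (_ , q)) = trans p (sym q)

inc-succMod : ∀ {k} (u : Vec Bool k) → SuccMod (2 ^ k) (val u) (val (inc u))
inc-succMod []          = inj₂ (refl , refl)
inc-succMod (false ∷ u) = inj₁ refl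
inc-succMod (true ∷ u) with inc-succMod u
... | inj₁ p       = inj₁ (trans (sym (*-suc 2 (val u))) (cong (2 *_) p))
... | inj₂ (p , q) = inj₂ (trans (sym (*-suc 2 (val u))) (cong (2 *_) p) , cong (2 *_) q)

⟦_⟧ : ∀ {A : Set} → Dec A → ℕ
⟦ d ⟧ = bit (does d)

⟦⟧-cong : ∀ {A B : Set} (d : Dec A) (d′ : Dec B) → (A → B) → (B → A) → ⟦ d ⟧ ≡ ⟦ d′ ⟧
⟦⟧-cong d d′ f g = cong bit (does-≡ (map′ f g d) d′)

_≟V_ : ∀ {k} → (u w : Vec Bool k) → Dec (u ≡ w)
_≟V_ = ≡-decVec _≟B_

isSuccMod-binary : ∀ {k} (u w : Vec Bool k) →
  bit (isSuccMod (2 ^ k) (toFin u) (toFin w)) ≡ ⟦ w ≟V inc u ⟧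
isSuccMod-binary {k} u w = begin
  bit (isSuccMod (2 ^ k) (toFin u) (toFin w))
    ≡⟨⟩ -- isSuccMod is the Boolean test of succMod?
  ⟦ succMod? (2 ^ k) (toℕ (toFin u)) (toℕ (toFin w)) ⟧
    ≡⟨ cong₂ (λ x y → ⟦ succMod? (2 ^ k) x y ⟧) (toℕ-fromℕ< (val< u)) (toℕ-fromℕ< (val< w)) ⟩
  ⟦ succMod? (2 ^ k) (val u) (val w) ⟧
    ≡⟨ ⟦⟧-cong (succMod? (2 ^ k) (val u) (val w)) (w ≟V inc u) is-inc is-succ ⟩
  ⟦ w ≟V inc u ⟧ ∎
  where
  open ≡-Reasoning
  is-inc : SuccMod (2 ^ k) (val u) (val w) → w ≡ inc u
  is-inc s = val-injective w (inc u) (succMod-unique (val< w) (val< (inc u)) s (inc-succMod u))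
  is-succ : w ≡ inc u → SuccMod (2 ^ k) (val u) (val w)
  is-succ refl = inc-succMod u

count : ∀ {A : Set} {P : Pred A _} → Decidable P → List A → ℕ
count P? xs = sum (map (λ x → ⟦ P? x ⟧) xs)

length-filter : ∀ {A : Set} {P : Pred A _} (P? : Decidable P) xs → length (filter P? xs) ≡ count P? xs
length-filter P? []       = refl
length-filter P? (x ∷ xs) with does (P? x)
... | true  = cong suc (length-filter P? xs)
... | false = length-filter P? xs

_≟C_ : ∀ {k} (c d : Vec Bool k × Bool) → Dec (c ≡ d)
(u , s) ≟C (w , t) = map′ (λ (p , q) → cong₂ _,_ p q) ,-injective ((u ≟V w) ×-dec (s ≟B t))

both-sides : ∀ p s t → bit (p ∧ does (s ≟B t)) + bit (p ∧ does (not s ≟B t)) ≡ bit p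
both-sides false s     t     = refl
both-sides true  false false = refl
both-sides true  false true  = refl
both-sides true  true  false = refl
both-sides true  true  true  = refl

module _ {n : ℕ} where

  -- position 0·φ(v) hosts (v,a⁻¹),(v,b⁻¹); position 1·φ(a⁻¹v) hosts (v,a),(v,b)
  pos : ZZVertex n → Vec Bool (suc n)
  pos (v , ℓa)  = true ∷ φ (bas-a⁻¹ v)
  pos (v , ℓa⁻) = false ∷ φ v
  pos (v , ℓb)  = true ∷ φ (bas-a⁻¹ v)
  pos (v , ℓb⁻) = false ∷ φ v

  side : ZZVertex n → Bool
  side (_ , ℓa)  = false
  side (_ , ℓa⁻) = false
  side (_ , ℓb)  = true
  side (_ , ℓb⁻) = true

  code : ZZVertex n → Vec Bool (suc n) × Bool
  code x = pos x , side x

  decode : Vec Bool (suc n) × Bool → ZZVertex n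
  decode (false ∷ u , false) = φ⁻¹ u , ℓa⁻
  decode (false ∷ u , true)  = φ⁻¹ u , ℓb⁻
  decode (true ∷ u , false)  = bas-a (φ⁻¹ u) , ℓa
  decode (true ∷ u , true)   = bas-a (φ⁻¹ u) , ℓb

  decode∘code : ∀ x → decode (code x) ≡ x
  decode∘code (v , ℓa)  = cong (_, ℓa) (trans (cong bas-a (φ⁻¹∘φ _)) (a∘a⁻¹ v))
  decode∘code (v , ℓa⁻) = cong (_, ℓa⁻) (φ⁻¹∘φ v)
  decode∘code (v , ℓb)  = cong (_, ℓb) (trans (cong bas-a (φ⁻¹∘φ _)) (a∘a⁻¹ v))
  decode∘code (v , ℓb⁻) = cong (_, ℓb⁻) (φ⁻¹∘φ v)

  code∘decode : ∀ c → code (decode c) ≡ c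
  code∘decode (false ∷ u , false) = cong (λ w → false ∷ w , false) (φ∘φ⁻¹ u)
  code∘decode (false ∷ u , true)  = cong (λ w → false ∷ w , true) (φ∘φ⁻¹ u)
  code∘decode (true ∷ u , false)  =
    cong (λ w → true ∷ w , false) (trans (cong φ (a⁻¹∘a _)) (φ∘φ⁻¹ u))
  code∘decode (true ∷ u , true)   =
    cong (λ w → true ∷ w , true) (trans (cong φ (a⁻¹∘a _)) (φ∘φ⁻¹ u))

  toDC : ZZVertex n ↔ DCVertex (2 ^ suc n)
  toDC = (binary ×-↔ ↔-id Bool) ↔-∘ mk↔ₛ′ code decode code∘decode decode∘code

  nb : ZZVertex n → Fin 2 → Fin 2 → ZZVertex n
  nb x i j = proj₁ (rotΓZ n x (i , j))

  PairAt : Vec Bool (suc n) → ZZVertex n → ZZVertex n → Set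
  PairAt P p q = pos p ≡ P × pos q ≡ P × side q ≡ not (side p)

  PredPair SuccPair : Vec Bool (suc n) → ZZVertex n → ZZVertex n → Set
  PredPair Q p q = ∃ λ P → inc P ≡ Q × PairAt P p q
  SuccPair Q p q = PairAt (inc Q) p q

  lower-pred : ∀ v → PredPair (false ∷ φ v) (bas-b v , ℓa) (bas-b v , ℓb)
  lower-pred v = _ , cong (false ∷_) inc-P , refl , refl , refl
    where
    inc-P : inc (φ (bas-a⁻¹ (bas-b v))) ≡ φ v
    inc-P = trans (sym (φ-conj (bas-a⁻¹ (bas-b v))))
                  (cong φ (trans (cong bas-b⁻¹ (a∘a⁻¹ (bas-b v))) (b⁻¹∘b v)))

  lower-succ : ∀ v → SuccPair (false ∷ φ v) (bas-a v , ℓb) (bas-a v , ℓa)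
  lower-succ v = at , at , refl
    where
    at : true ∷ φ (bas-a⁻¹ (bas-a v)) ≡ true ∷ φ v
    at = cong (λ w → true ∷ φ w) (a⁻¹∘a v)

  upper-pred : ∀ v → PredPair (true ∷ φ (bas-a⁻¹ v)) (bas-a⁻¹ v , ℓa⁻) (bas-a⁻¹ v , ℓb⁻)
  upper-pred v = _ , refl , refl , refl , refl

  upper-succ : ∀ v → SuccPair (true ∷ φ (bas-a⁻¹ v)) (bas-b⁻¹ v , ℓb⁻) (bas-b⁻¹ v , ℓa⁻)
  upper-succ v = at , at , refl
    where
    at : false ∷ φ (bas-b⁻¹ v) ≡ false ∷ inc (φ (bas-a⁻¹ v))
    at = cong (false ∷_) (trans (cong (λ w → φ (bas-b⁻¹ w)) (sym (a∘a⁻¹ v))) (φ-conj (bas-a⁻¹ v)))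

  neighbour-pairs : ∀ x →
      (PredPair (pos x) (nb x fwd fwd) (nb x fwd bwd) × SuccPair (pos x) (nb x bwd fwd) (nb x bwd bwd))
    ⊎ (SuccPair (pos x) (nb x fwd fwd) (nb x fwd bwd) × PredPair (pos x) (nb x bwd fwd) (nb x bwd bwd))
  neighbour-pairs (v , ℓa⁻) = inj₁ (lower-pred v , lower-succ v)
  neighbour-pairs (v , ℓb⁻) = inj₂ (lower-succ v , lower-pred v)
  neighbour-pairs (v , ℓa)  = inj₁ (upper-pred v , upper-succ v)
  neighbour-pairs (v , ℓb)  = inj₂ (upper-succ v , upper-pred v)

  hits : ZZVertex n → ZZVertex n → Fin 2 → Fin 2 → ℕ
  hits x y i j = ⟦ nb x i j ≟ZZ y ⟧

  multΓZ-labels : ∀ x y → multΓZ n x y ≡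
    (hits x y fwd fwd + hits x y fwd bwd) + (hits x y bwd fwd + hits x y bwd bwd)
  multΓZ-labels x y = begin
    multΓZ n x y                 ≡⟨ length-filter (λ ij → proj₁ (rotΓZ n x ij) ≟ZZ y) zzLabels ⟩
    h₀₀ + (h₀₁ + (h₁₀ + (h₁₁ + 0))) ≡⟨ cong (λ t → h₀₀ + (h₀₁ + (h₁₀ + t))) (+-identityʳ h₁₁) ⟩
    h₀₀ + (h₀₁ + (h₁₀ + h₁₁))       ≡⟨ sym (+-assoc h₀₀ h₀₁ (h₁₀ + h₁₁)) ⟩
    (h₀₀ + h₀₁) + (h₁₀ + h₁₁)       ∎
    where
    open ≡-Reasoning
    h₀₀ = hits x y fwd fwd
    h₀₁ = hits x y fwd bwd
    h₁₀ = hits x y bwd fwd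
    h₁₁ = hits x y bwd bwd

  code-hits : ∀ p y → ⟦ p ≟ZZ y ⟧ ≡ ⟦ code p ≟C code y ⟧
  code-hits p y = ⟦⟧-cong (p ≟ZZ y) (code p ≟C code y) (cong code)
    (λ eq → trans (sym (decode∘code p)) (trans (cong decode eq) (decode∘code y)))

  pair-hits : ∀ {P p q} → PairAt P p q → ∀ y → ⟦ p ≟ZZ y ⟧ + ⟦ q ≟ZZ y ⟧ ≡ ⟦ P ≟V pos y ⟧
  pair-hits {P} {p} {q} (pos-p , pos-q , side-q) y = begin
    ⟦ p ≟ZZ y ⟧ + ⟦ q ≟ZZ y ⟧
      ≡⟨ cong₂ _+_ (code-hits p y) (code-hits q y) ⟩
    ⟦ (pos p , side p) ≟C code y ⟧ + ⟦ (pos q , side q) ≟C code y ⟧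
      ≡⟨ cong₂ (λ u c → ⟦ (u , side p) ≟C code y ⟧ + ⟦ c ≟C code y ⟧) pos-p (cong₂ _,_ pos-q side-q) ⟩
    ⟦ (P , side p) ≟C code y ⟧ + ⟦ (P , not (side p)) ≟C code y ⟧
      ≡⟨ both-sides (does (P ≟V pos y)) (side p) (side y) ⟩
    ⟦ P ≟V pos y ⟧ ∎
    where open ≡-Reasoning

  pred-hits : ∀ {Q p q} → PredPair Q p q → ∀ y → ⟦ p ≟ZZ y ⟧ + ⟦ q ≟ZZ y ⟧ ≡ ⟦ Q ≟V inc (pos y) ⟧
  pred-hits {Q} (P , inc-P , pair) y = trans (pair-hits pair y)
    (⟦⟧-cong (P ≟V pos y) (Q ≟V inc (pos y))
      (λ eq → trans (sym inc-P) (cong inc eq)) (λ eq → inc-injective P (pos y) (trans inc-P eq)))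

  succ-hits : ∀ {Q p q} → SuccPair Q p q → ∀ y → ⟦ p ≟ZZ y ⟧ + ⟦ q ≟ZZ y ⟧ ≡ ⟦ pos y ≟V inc Q ⟧
  succ-hits {Q} pair y = trans (pair-hits pair y) (⟦⟧-cong (inc Q ≟V pos y) (pos y ≟V inc Q) sym sym)

  neighbour-hits : ∀ x y →
    (hits x y fwd fwd + hits x y fwd bwd) + (hits x y bwd fwd + hits x y bwd bwd) ≡
    ⟦ pos y ≟V inc (pos x) ⟧ + ⟦ pos x ≟V inc (pos y) ⟧
  neighbour-hits x y with neighbour-pairs x
  ... | inj₁ (pp , sp) = trans (cong₂ _+_ (pred-hits pp y) (succ-hits sp y))
                           (+-comm ⟦ pos x ≟V inc (pos y) ⟧ ⟦ pos y ≟V inc (pos x) ⟧)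
  ... | inj₂ (sp , pp) = cong₂ _+_ (succ-hits sp y) (pred-hits pp y)

  dc-mult : ∀ x y → multDC (2 ^ suc n) (Inverse.to toDC x) (Inverse.to toDC y) ≡
    ⟦ pos y ≟V inc (pos x) ⟧ + ⟦ pos x ≟V inc (pos y) ⟧
  dc-mult x y = cong₂ _+_ (isSuccMod-binary (pos x) (pos y)) (isSuccMod-binary (pos y) (pos x))

  multiplicity : ∀ x y → multΓZ n x y ≡ multDC (2 ^ suc n) (Inverse.to toDC x) (Inverse.to toDC y)
  multiplicity x y = trans (multΓZ-labels x y) (trans (neighbour-hits x y) (sym (dc-mult x y)))

proposition6p1 : (n : ℕ) →
    SingleParityBlock (RotΓ n) × ConnectedΓZ n × IsoToDC n (2 ^ suc n)
proposition6p1 n = single-parity-block , connected , toDC , multiplicity
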